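{- Let $G$ and $H$ be vertex-disjoint strongly connected graphs, let $v_1\ne v_2$ be vertices of $G$ and $w_1\ne w_2$ be vertices of $H$. Let $G\bullet H$ be obtained from $G\cup H$ by identifying $v_1$ with $w_1$ and $v_2$ with $w_2$, and let $G\circ H$ be obtained from $G\cup H$ by identifying $v_1$ with $w_2$ and $v_2$ with $w_1$. If both $w_1$ and $w_2$ are simple vertices of $H$, then $\mathcal{K}(G\bullet H)\simeq\mathcal{K}(G\circ H)$.
   Context: A graph is a finite directed multigraph. For $G=(V,E)$, $A$ is the $V\times V$ matrix with $A_{vw}$ the number of directed edges from $v$ to $w$, $\Delta$ is diagonal with $\Delta_{vv}=\sum_wA_{vw}$, $Q=\Delta-A$, $\dagger$ denotes transpose, and $\mathcal{K}(G)=\mathbf{Z}^V/Q^{\dagger}\mathbf{Z}^V$. For strongly connected $H$, the activity vector $\mathbf{h}$ is the unique vector with positive integer entries, $\gcd$ of entries equal to $1$, and $Q(H)^{\dagger}\mathbf{h}=\mathbf{0}$; a vertex $w$ is simple if $h(w)=1$. -}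

module Defs where

open import Data.Nat as ℕ using (ℕ; zero; suc)
open import Data.Nat.GCD using (gcd)
open import Data.Integer as ℤ using (ℤ; +_)
open import Data.Fin using (Fin; zero; suc; splitAt; _≟_)
open import Data.Sum using (_⊎_; inj₁; inj₂)
open import Data.Product using (_×_; ∃; Σ; _,_)
open import Relation.Nullary using (yes; no; ¬_)
open import Relation.Nullary.Decidable using (⌊_⌋)
open import Relation.Binary.PropositionalEquality using (_≡_)
open import Function.Bundles using (_⇔_)
open import Algebra.Bundles using (RawGroup)
open import Algebra.Morphism.Structures using (module GroupMorphisms)

-- A graph on vertex set Fin n, given by its adjacency matrix:
-- A v w = number of directed edges from v to w.
Graph : ℕ → Set
Graph n = Fin n → Fin n → ℕ

∑ : ∀ {n} → (Fin n → ℕ) → ℕ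
∑ {zero}  f = 0
∑ {suc n} f = f zero ℕ.+ ∑ (λ i → f (suc i))

∑ℤ : ∀ {n} → (Fin n → ℤ) → ℤ
∑ℤ {zero}  f = + 0
∑ℤ {suc n} f = f zero ℤ.+ ∑ℤ (λ i → f (suc i))

gcdAll : ∀ {n} → (Fin n → ℕ) → ℕ
gcdAll {zero}  f = 0
gcdAll {suc n} f = gcd (f zero) (gcdAll (λ i → f (suc i)))

outdeg : ∀ {n} → Graph n → Fin n → ℕ
outdeg A v = ∑ (λ w → A v w)

Lap : ∀ {n} → Graph n → Fin n → Fin n → ℤ
Lap A i j with i ≟ j
... | yes _ = + outdeg A i ℤ.- + A i j
... | no  _ = ℤ.- (+ A i j)

QT : ∀ {n} → Graph n → (Fin n → ℤ) → (Fin n → ℤ)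
QT A z i = ∑ℤ (λ j → Lap A j i ℤ.* z j)

QTℕ : ∀ {n} → Graph n → (Fin n → ℕ) → (Fin n → ℤ)
QTℕ A h = QT A (λ i → + h i)

data Reach {n} (A : Graph n) : Fin n → Fin n → Set where
  here : ∀ {v} → Reach A v v
  step : ∀ {u v w} → 1 ℕ.≤ A u v → Reach A v w → Reach A u w

StronglyConnected : ∀ {n} → Graph n → Set
StronglyConnected A = ∀ v w → Reach A v w

IsActivity : ∀ {n} → Graph n → (Fin n → ℕ) → Set
IsActivity A h = (∀ i → 1 ℕ.≤ h i) × gcdAll h ≡ 1 × (∀ i → QTℕ A h i ≡ + 0)

Simple : ∀ {n} → Graph n → Fin n → Set
Simple A w = ∃ λ h → IsActivity A h × h w ≡ 1

-- Sandpile group 𝒦(G) = ℤ^V / Q† ℤ^V, as a raw group on ℤ^V with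
-- equality "congruent modulo the image of Q†".
_≈K[_]_ : ∀ {n} → (Fin n → ℤ) → Graph n → (Fin n → ℤ) → Set
x ≈K[ A ] y = ∃ λ z → ∀ i → x i ℤ.- y i ≡ QT A z i

𝒦 : ∀ {n} → Graph n → RawGroup _ _
𝒦 {n} A = record
  { Carrier = Fin n → ℤ
  ; _≈_     = λ x y → x ≈K[ A ] y
  ; _∙_     = λ x y i → x i ℤ.+ y i
  ; ε       = λ _ → + 0
  ; _⁻¹     = λ x i → ℤ.- x i
  }

_≅_ : ∀ {a b ℓ₁ ℓ₂} → RawGroup a ℓ₁ → RawGroup b ℓ₂ → Set _
G₁ ≅ G₂ = ∃ λ φ → IsGroupIsomorphism φ
  where open GroupMorphisms G₁ G₂

union : ∀ {m k} → Graph m → Graph k → Graph (m ℕ.+ k)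
union {m} G H x y with splitAt m x | splitAt m y
... | inj₁ a | inj₁ b = G a b
... | inj₂ a | inj₂ b = H a b
... | _      | _      = 0

-- graph image under a vertex map f : Fin n → Fin p (all edges kept,
-- including those becoming loops)
image : ∀ {n p} → (Fin n → Fin p) → Graph n → Graph p
image f A a b = ∑ (λ x → ∑ (λ y → cnt x y))
  where
  cnt : _ → _ → ℕ
  cnt x y with f x ≟ a | f y ≟ b
  ... | yes _ | yes _ = A x y
  ... | _     | _     = 0

IdentifiesExactly : ∀ {n p} → (Fin n → Fin p) → Fin n → Fin n → Fin n → Fin n → Set
IdentifiesExactly f a b c d =
  (∀ q → ∃ λ x → f x ≡ q) ×
  (∀ x y → (f x ≡ f y) ⇔
     (x ≡ y ⊎ (x ≡ a × y ≡ b) ⊎ (x ≡ b × y ≡ a) ⊎ (x ≡ c × y ≡ d) ⊎ (x ≡ d × y ≡ c)))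

{-# OPTIONS --safe #-}
module Submission where

-- The vertex sets of G • H and G ∘ H are quotients of that of G ∪ H by maps f and g, and
-- Q(image f A)† z is the fibrewise sum (push f) of Q(A)† (z ∘ f).  Since the nonnegative
-- kernel of Q(H)† is a line, the simple vertices w₁, w₂ have h w₁ = h w₂ = 1 for one activity
-- vector h of H.  The map Ψ fixing the G-coordinates and sending the H-coordinates y to
-- −y + (Σ y)(δ w₁ + δ w₂) is an involution.  Its transpose turns g-invariant vectors into
-- f-invariant ones, so Ψ maps the kernel of push f into that of push g; and since Q(H)† c has
-- coordinate sum 0, Ψ (Q† c) = Q† c″ with c″ = −c + (c v₁ + c v₂) h on H, which is g-invariant
-- whenever c is f-invariant.  Hence push g ∘ Ψ ∘ (a section of push f) induces
-- 𝒦(G • H) ≅ 𝒦(G ∘ H), with inverse given by the same construction with f and g exchanged.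

open import Defs
open import Data.Nat using (ℕ)
open import Data.Fin using (Fin; _↑ˡ_; _↑ʳ_)
open import Data.Product using (_,_)
open import Relation.Binary.PropositionalEquality using (_≡_; refl)
open import Relation.Nullary using (¬_)

module _ where
  open import Data.Nat as ℕ using (zero; suc)
  import Data.Nat.Properties as ℕ
  open import Data.Integer as ℤ using (ℤ; +_; _+_; _*_; -_; _-_)
  import Data.Integer.Properties as ℤ
  open import Data.Integer.Tactic.RingSolver using (solve-∀)
  open import Data.Fin as Fin using (zero; suc; _≟_; splitAt; punchIn)
  import Data.Fin.Properties as Fin
  open import Data.Vec.Functional using (Vector; take; drop; _++_; zipWith; map; replicate)
  open import Data.Vec.Functional.Properties using (lookup-++ˡ; lookup-++ʳ; ++-cong)
  open import Data.Sum using (_⊎_; inj₁; inj₂; [_,_]′)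
  open import Data.Product using (Σ; ∃; _×_; proj₁; proj₂)
  open import Function using (_∘_; id; Equivalence)
  open import Level using (0ℓ)
  open import Relation.Binary.Bundles using (Setoid)
  import Relation.Binary.Reasoning.Setoid as SetoidReasoning
  open import Relation.Nullary using (Dec; yes; no; contradiction)
  open import Relation.Binary.PropositionalEquality
    using (sym; trans; cong; cong₂; _≗_; _≢_; module ≡-Reasoning)
  open import Algebra.Properties.Semiring.Sum ℤ.+-*-semiring
    using ( sum; sum-cong-≗; sum-replicate-zero; sum-remove; ∑-distrib-+; ∑-comm
          ; *-distribˡ-sum; *-distribʳ-sum)
  import Algebra.Properties.CommutativeSemigroup ℕ.*-commutativeSemigroup as ℕ*
  import Algebra.Properties.CommutativeSemigroup ℤ.*-commutativeSemigroup as ℤ*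
  open import Algebra.Properties.AbelianGroup ℤ.+-0-abelianGroup
    using (identityˡ-unique; inverseˡ-unique)

  -- Integer vectors and finite sums

  infixl 6 _⊕_ _⊖_
  infixr 7 _⊙_
  infix 8 ⊝_

  𝟎 : ∀ {n} → Vector ℤ n
  𝟎 = replicate _ (+ 0)

  _⊕_ : ∀ {n} → Vector ℤ n → Vector ℤ n → Vector ℤ n
  _⊕_ = zipWith _+_

  ⊝_ : ∀ {n} → Vector ℤ n → Vector ℤ n
  (⊝ x) i = - x i

  _⊖_ : ∀ {n} → Vector ℤ n → Vector ℤ n → Vector ℤ n
  x ⊖ y = x ⊕ ⊝ y

  _⊙_ : ∀ {n} → ℤ → Vector ℤ n → Vector ℤ n
  t ⊙ x = map (t *_) x

  ⟨_,_⟩ : ∀ {n} → Vector ℤ n → Vector ℤ n → ℤ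
  ⟨ x , y ⟩ = sum (zipWith _*_ x y)

  ∑ℤ≡sum : ∀ {n} (t : Vector ℤ n) → ∑ℤ t ≡ sum t
  ∑ℤ≡sum {zero}  t = refl
  ∑ℤ≡sum {suc n} t = cong (_+_ (t zero)) (∑ℤ≡sum (t ∘ suc))

  +∑≡sum : ∀ {n} (t : Vector ℕ n) → + ∑ t ≡ sum (+_ ∘ t)
  +∑≡sum {zero}  t = refl
  +∑≡sum {suc n} t = trans (ℤ.pos-+ (t zero) _) (cong (_+_ (+ t zero)) (+∑≡sum (t ∘ suc)))

  ∑≡0⇒≡0 : ∀ {n} (t : Vector ℕ n) → ∑ t ≡ 0 → ∀ i → t i ≡ 0
  ∑≡0⇒≡0 t eq zero    = ℕ.m+n≡0⇒m≡0 (t zero) eq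
  ∑≡0⇒≡0 t eq (suc i) = ∑≡0⇒≡0 (t ∘ suc) (ℕ.m+n≡0⇒n≡0 (t zero) eq) i

  sum-zero : ∀ {n} {t : Vector ℤ n} → t ≗ 𝟎 → sum t ≡ + 0
  sum-zero {n} t≗0 = trans (sum-cong-≗ t≗0) (sum-replicate-zero n)

  sum-neg : ∀ {n} (t : Vector ℤ n) → sum (λ i → - t i) ≡ - sum t
  sum-neg t = begin
    sum (λ i → - t i)        ≡⟨ sum-cong-≗ (λ i → sym (ℤ.-1*i≡-i (t i))) ⟩
    sum (λ i → ℤ.-1ℤ * t i)  ≡⟨ *-distribˡ-sum ℤ.-1ℤ t ⟨
    ℤ.-1ℤ * sum t            ≡⟨ ℤ.-1*i≡-i (sum t) ⟩
    - sum t                  ∎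
    where open ≡-Reasoning

  sum-supported : ∀ {n} (t : Vector ℤ n) i → (∀ j → j ≢ i → t j ≡ + 0) → sum t ≡ t i
  sum-supported {suc n} t i off = begin
    sum t
      ≡⟨ sum-remove {i = i} t ⟩
    t i + sum (t ∘ punchIn i)
      ≡⟨ cong (_+_ (t i)) (sum-zero (λ j → off (punchIn i j) (Fin.punchInᵢ≢i i j))) ⟩
    t i + + 0
      ≡⟨ ℤ.+-identityʳ (t i) ⟩
    t i ∎
    where open ≡-Reasoning

  sum-↑ : ∀ m {k} (t : Vector ℤ (m ℕ.+ k)) → sum t ≡ sum (take m t) + sum (drop m t)
  sum-↑ zero    t = sym (ℤ.+-identityˡ (sum t))
  sum-↑ (suc m) t = trans (cong (_+_ (t zero)) (sum-↑ m (t ∘ suc))) (sym (ℤ.+-assoc (t zero) _ _))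

  𝟙 : ∀ {p} {P : Set p} → Dec P → ℤ
  𝟙 (yes _) = + 1
  𝟙 (no _)  = + 0

  δ : ∀ {n} → Fin n → Fin n → ℤ
  δ i j = 𝟙 (i ≟ j)

  𝟙-yes : ∀ {p} {P : Set p} (d : Dec P) → P → 𝟙 d ≡ + 1
  𝟙-yes (yes _) _ = refl
  𝟙-yes (no ¬p) p = contradiction p ¬p

  𝟙-no : ∀ {p} {P : Set p} (d : Dec P) → ¬ P → 𝟙 d ≡ + 0
  𝟙-no (yes p) ¬p = contradiction p ¬p
  𝟙-no (no _)  _  = refl

  δ-comm : ∀ {n} (i j : Fin n) → δ i j ≡ δ j i
  δ-comm i j with i ≟ j | j ≟ i
  ... | yes _   | yes _   = refl
  ... | no _    | no _    = refl
  ... | yes i≡j | no j≢i  = contradiction (sym i≡j) j≢i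
  ... | no i≢j  | yes j≡i = contradiction (sym j≡i) i≢j

  sum-δ : ∀ {n} (i : Fin n) (t : Vector ℤ n) → sum (λ j → δ i j * t j) ≡ t i
  sum-δ i t = begin
    sum (λ j → δ i j * t j) ≡⟨ sum-supported _ i off-diagonal ⟩
    δ i i * t i             ≡⟨ cong (_* t i) (𝟙-yes (i ≟ i) refl) ⟩
    + 1 * t i               ≡⟨ ℤ.*-identityˡ (t i) ⟩
    t i                     ∎
    where
    open ≡-Reasoning
    off-diagonal : ∀ j → j ≢ i → δ i j * t j ≡ + 0
    off-diagonal j j≢i = cong (_* t j) (𝟙-no (i ≟ j) (j≢i ∘ sym))

  sum-δᵀ : ∀ {n} (i : Fin n) (t : Vector ℤ n) → sum (λ j → δ j i * t j) ≡ t i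
  sum-δᵀ i t = trans (sum-cong-≗ (λ j → cong (_* t j) (δ-comm j i))) (sum-δ i t)

  δ-transport : ∀ {n} (i j : Fin n) (F : Fin n → ℤ) → δ i j * F i ≡ δ i j * F j
  δ-transport i j F with i ≟ j
  ... | yes refl = refl
  ... | no _     = refl

  sum-fibres : ∀ {n p} (f : Fin n → Fin p) (t : Fin n → Fin p → ℤ) →
               sum (λ b → sum (λ x → δ (f x) b * t x b)) ≡ sum (λ x → t x (f x))
  sum-fibres f t =
    trans (∑-comm (λ b x → δ (f x) b * t x b)) (sum-cong-≗ (λ x → sum-δ (f x) (t x)))

  ⟨⟩-congˡ : ∀ {n} {x x′ : Vector ℤ n} → x ≗ x′ → ∀ y → ⟨ x , y ⟩ ≡ ⟨ x′ , y ⟩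
  ⟨⟩-congˡ x≗x′ y = sum-cong-≗ (λ i → cong (_* y i) (x≗x′ i))

  ⟨⟩-congʳ : ∀ {n} x {y y′ : Vector ℤ n} → y ≗ y′ → ⟨ x , y ⟩ ≡ ⟨ x , y′ ⟩
  ⟨⟩-congʳ x y≗y′ = sum-cong-≗ (λ i → cong (x i *_) (y≗y′ i))

  ⟨⟩-↑ : ∀ m {k} (x y : Vector ℤ (m ℕ.+ k)) →
         ⟨ x , y ⟩ ≡ ⟨ take m x , take m y ⟩ + ⟨ drop m x , drop m y ⟩
  ⟨⟩-↑ m x y = sum-↑ m (zipWith _*_ x y)

  take-++-drop : ∀ m {k} {A : Set} (y : Vector A (m ℕ.+ k)) → take m y ++ drop m y ≗ y
  take-++-drop m y i with splitAt m i in eq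
  ... | inj₁ j = cong y (Fin.splitAt⁻¹-↑ˡ eq)
  ... | inj₂ j = cong y (Fin.splitAt⁻¹-↑ʳ eq)

  ≗-blocks : ∀ m {k} {A : Set} {x y : Vector A (m ℕ.+ k)} →
             take m x ≗ take m y → drop m x ≗ drop m y → x ≗ y
  ≗-blocks m {x = x} {y} take≗ drop≗ i = begin
    x i                        ≡⟨ take-++-drop m x i ⟨
    (take m x ++ drop m x) i   ≡⟨ ++-cong (take m x) (take m y) take≗ drop≗ i ⟩
    (take m y ++ drop m y) i   ≡⟨ take-++-drop m y i ⟩
    y i                        ∎
    where open ≡-Reasoning

  sum-take : ∀ m {k} (t : Vector ℤ (m ℕ.+ k)) → drop m t ≗ 𝟎 → sum t ≡ sum (take m t)
  sum-take m t drop≗𝟎 =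
    trans (sum-↑ m t) (trans (cong (_+_ (sum (take m t))) (sum-zero drop≗𝟎)) (ℤ.+-identityʳ _))

  sum-drop : ∀ m {k} (t : Vector ℤ (m ℕ.+ k)) → take m t ≗ 𝟎 → sum t ≡ sum (drop m t)
  sum-drop m t take≗𝟎 =
    trans (sum-↑ m t) (trans (cong (_+ sum (drop m t)) (sum-zero take≗𝟎)) (ℤ.+-identityˡ _))

  -- Linear maps

  record IsLinear {m n} (φ : Vector ℤ m → Vector ℤ n) : Set where
    field
      cong-≗ : ∀ {x y} → x ≗ y → φ x ≗ φ y
      ⊕-homo : ∀ x y → φ (x ⊕ y) ≗ φ x ⊕ φ y

    𝟎-homo : φ 𝟎 ≗ 𝟎
    𝟎-homo i = identityˡ-unique (φ 𝟎 i) (φ 𝟎 i) (sym (⊕-homo 𝟎 𝟎 i))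

    ⊝-homo : ∀ x → φ (⊝ x) ≗ ⊝ φ x
    ⊝-homo x i = inverseˡ-unique (φ (⊝ x) i) (φ x i) (begin
      φ (⊝ x) i + φ x i  ≡⟨ ⊕-homo (⊝ x) x i ⟨
      φ (⊝ x ⊕ x) i      ≡⟨ cong-≗ (λ j → ℤ.+-inverseˡ (x j)) i ⟩
      φ 𝟎 i              ≡⟨ 𝟎-homo i ⟩
      + 0                ∎)
      where open ≡-Reasoning

    ⊖-homo : ∀ x y → φ (x ⊖ y) ≗ φ x ⊖ φ y
    ⊖-homo x y i = trans (⊕-homo x (⊝ y) i) (cong (_+_ (φ x i)) (⊝-homo y i))

  ∘-linear : ∀ {m n o} {φ : Vector ℤ m → Vector ℤ n} {ψ : Vector ℤ n → Vector ℤ o} →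
             IsLinear φ → IsLinear ψ → IsLinear (ψ ∘ φ)
  ∘-linear φ-lin ψ-lin = record
    { cong-≗ = λ x≗y → ψ.cong-≗ (φ.cong-≗ x≗y)
    ; ⊕-homo = λ x y i → trans (ψ.cong-≗ (φ.⊕-homo x y) i) (ψ.⊕-homo _ _ i)
    }
    where
    module φ = IsLinear φ-lin
    module ψ = IsLinear ψ-lin

  _*ᵥ_ : ∀ {m n} → (Fin m → Fin n → ℤ) → Vector ℤ n → Vector ℤ m
  (M *ᵥ x) i = sum (λ j → M i j * x j)

  *ᵥ-linear : ∀ {m n} (M : Fin m → Fin n → ℤ) → IsLinear (M *ᵥ_)
  *ᵥ-linear M = record
    { cong-≗ = λ x≗y i → sum-cong-≗ (λ j → cong (M i j *_) (x≗y j))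
    ; ⊕-homo = λ x y i → trans (sum-cong-≗ (λ j → ℤ.*-distribˡ-+ (M i j) (x j) (y j)))
                               (∑-distrib-+ (λ j → M i j * x j) (λ j → M i j * y j))
    }

  *ᵥ-⊙ : ∀ {m n} (M : Fin m → Fin n → ℤ) t x → M *ᵥ (t ⊙ x) ≗ t ⊙ (M *ᵥ x)
  *ᵥ-⊙ M t x i =
    trans (sum-cong-≗ (λ j → ℤ*.x∙yz≈y∙xz (M i j) t (x j))) (sym (*-distribˡ-sum t (λ j → M i j * x j)))

  linear-≗ : ∀ {m n} {φ ψ : Vector ℤ m → Vector ℤ n} →
             (∀ x → φ x ≗ ψ x) → IsLinear ψ → IsLinear φ
  linear-≗ {φ = φ} {ψ} φ≗ψ ψ-lin = record
    { cong-≗ = λ {x} {y} x≗y i → trans (φ≗ψ x i) (trans (ψ.cong-≗ x≗y i) (sym (φ≗ψ y i)))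
    ; ⊕-homo = λ x y i → trans (φ≗ψ (x ⊕ y) i)
                               (trans (ψ.⊕-homo x y i) (sym (cong₂ _+_ (φ≗ψ x i) (φ≗ψ y i))))
    }
    where module ψ = IsLinear ψ-lin

  -- Laplacians

  Q† : ∀ {n} → Graph n → Fin n → Fin n → ℤ
  Q† A i j = Lap A j i

  QT≗Q†*ᵥ : ∀ {n} (A : Graph n) z → QT A z ≗ Q† A *ᵥ z
  QT≗Q†*ᵥ A z i = ∑ℤ≡sum (λ j → Lap A j i * z j)

  QT-linear : ∀ {n} (A : Graph n) → IsLinear (QT A)
  QT-linear A = linear-≗ (QT≗Q†*ᵥ A) (*ᵥ-linear (Q† A))

  QT-⊙ : ∀ {n} (A : Graph n) t z → QT A (t ⊙ z) ≗ t ⊙ QT A z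
  QT-⊙ A t z i =
    trans (QT≗Q†*ᵥ A (t ⊙ z) i) (trans (*ᵥ-⊙ (Q† A) t z i) (cong (t *_) (sym (QT≗Q†*ᵥ A z i))))

  _ᵀ*ᵥ_ : ∀ {n} → Graph n → Vector ℤ n → Vector ℤ n
  (A ᵀ*ᵥ z) i = sum (λ j → + A j i * z j)

  Lap≡Δ-A : ∀ {n} (A : Graph n) i j → Lap A i j ≡ δ i j * + outdeg A i - + A i j
  Lap≡Δ-A A i j with i ≟ j
  ... | yes _ = cong (_- + A i j) (sym (ℤ.*-identityˡ (+ outdeg A i)))
  ... | no _  = sym (ℤ.+-identityˡ (- + A i j))

  QT≡Δ-Aᵀ : ∀ {n} (A : Graph n) z i → QT A z i ≡ + outdeg A i * z i - (A ᵀ*ᵥ z) i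
  QT≡Δ-Aᵀ A z i = begin
    QT A z i                                               ≡⟨ QT≗Q†*ᵥ A z i ⟩
    sum (λ j → Lap A j i * z j)                            ≡⟨ sum-cong-≗ term ⟩
    sum (λ j → δ j i * (+ outdeg A j * z j) + - (+ A j i * z j))
      ≡⟨ ∑-distrib-+ (λ j → δ j i * (+ outdeg A j * z j)) (λ j → - (+ A j i * z j)) ⟩
    sum (λ j → δ j i * (+ outdeg A j * z j)) + sum (λ j → - (+ A j i * z j))
      ≡⟨ cong₂ _+_ (sum-δᵀ i (λ j → + outdeg A j * z j)) (sum-neg (λ j → + A j i * z j)) ⟩
    + outdeg A i * z i - (A ᵀ*ᵥ z) i                       ∎
    where
    open ≡-Reasoning
    expand : ∀ d o a x → (d * o - a) * x ≡ d * (o * x) + - (a * x)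
    expand = solve-∀
    term : ∀ j → Lap A j i * z j ≡ δ j i * (+ outdeg A j * z j) + - (+ A j i * z j)
    term j = trans (cong (_* z j) (Lap≡Δ-A A j i)) (expand (δ j i) (+ outdeg A j) (+ A j i) (z j))

  sum-QT : ∀ {n} (A : Graph n) z → sum (QT A z) ≡ + 0
  sum-QT A z = begin
    sum (QT A z)                                      ≡⟨ sum-cong-≗ (QT≡Δ-Aᵀ A z) ⟩
    sum (λ i → Δz i + - (A ᵀ*ᵥ z) i)                  ≡⟨ ∑-distrib-+ Δz (λ i → - (A ᵀ*ᵥ z) i) ⟩
    sum Δz + sum (λ i → - (A ᵀ*ᵥ z) i)                ≡⟨ cong (_+_ (sum Δz)) (sum-neg (A ᵀ*ᵥ z)) ⟩
    sum Δz - sum (A ᵀ*ᵥ z)                            ≡⟨ cong (λ s → sum Δz - s) outflow ⟩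
    sum Δz - sum Δz                                   ≡⟨ ℤ.+-inverseʳ (sum Δz) ⟩
    + 0                                               ∎
    where
    open ≡-Reasoning
    Δz : Vector ℤ _
    Δz j = + outdeg A j * z j
    row : ∀ j → sum (λ i → + A j i * z j) ≡ Δz j
    row j = trans (sym (*-distribʳ-sum (z j) (λ i → + A j i))) (cong (_* z j) (sym (+∑≡sum (A j))))
    outflow : sum (A ᵀ*ᵥ z) ≡ sum Δz
    outflow = trans (∑-comm (λ i j → + A j i * z j)) (sum-cong-≗ row)

  module _ {m k} (G : Graph m) (H : Graph k) where

    union-ˡˡ : ∀ i i′ → union G H (i ↑ˡ k) (i′ ↑ˡ k) ≡ G i i′
    union-ˡˡ i i′ rewrite Fin.splitAt-↑ˡ m i k | Fin.splitAt-↑ˡ m i′ k = refl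

    union-ʳʳ : ∀ j j′ → union G H (m ↑ʳ j) (m ↑ʳ j′) ≡ H j j′
    union-ʳʳ j j′ rewrite Fin.splitAt-↑ʳ m k j | Fin.splitAt-↑ʳ m k j′ = refl

    union-ˡʳ : ∀ i j → union G H (i ↑ˡ k) (m ↑ʳ j) ≡ 0
    union-ˡʳ i j rewrite Fin.splitAt-↑ˡ m i k | Fin.splitAt-↑ʳ m k j = refl

    union-ʳˡ : ∀ j i → union G H (m ↑ʳ j) (i ↑ˡ k) ≡ 0
    union-ʳˡ j i rewrite Fin.splitAt-↑ʳ m k j | Fin.splitAt-↑ˡ m i k = refl

    QT-union-take : ∀ c → take m (QT (union G H) c) ≗ QT G (take m c)
    QT-union-take c i = begin
      QT U c (i ↑ˡ k)
        ≡⟨ QT≡Δ-Aᵀ U c (i ↑ˡ k) ⟩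
      + outdeg U (i ↑ˡ k) * c (i ↑ˡ k) - (U ᵀ*ᵥ c) (i ↑ˡ k)
        ≡⟨ cong₂ (λ o a → o * c (i ↑ˡ k) - a) (outdegˡ i) (inflowˡ i) ⟩
      + outdeg G i * take m c i - (G ᵀ*ᵥ take m c) i
        ≡⟨ QT≡Δ-Aᵀ G (take m c) i ⟨
      QT G (take m c) i ∎
      where
      open ≡-Reasoning
      U = union G H
      outdegˡ : ∀ i → + outdeg U (i ↑ˡ k) ≡ + outdeg G i
      outdegˡ i = begin
        + outdeg U (i ↑ˡ k)                 ≡⟨ +∑≡sum (U (i ↑ˡ k)) ⟩
        sum (λ x → + U (i ↑ˡ k) x)          ≡⟨ sum-take m _ (λ j → cong +_ (union-ˡʳ i j)) ⟩
        sum (λ i′ → + U (i ↑ˡ k) (i′ ↑ˡ k)) ≡⟨ sum-cong-≗ (λ i′ → cong +_ (union-ˡˡ i i′)) ⟩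
        sum (λ i′ → + G i i′)               ≡⟨ +∑≡sum (G i) ⟨
        + outdeg G i                        ∎
      inflowˡ : ∀ i → (U ᵀ*ᵥ c) (i ↑ˡ k) ≡ (G ᵀ*ᵥ take m c) i
      inflowˡ i = trans (sum-take m _ (λ j → cong (λ a → + a * c (m ↑ʳ j)) (union-ʳˡ j i)))
                        (sum-cong-≗ (λ i′ → cong (λ a → + a * c (i′ ↑ˡ k)) (union-ˡˡ i′ i)))

    QT-union-drop : ∀ c → drop m (QT (union G H) c) ≗ QT H (drop m c)
    QT-union-drop c j = begin
      QT U c (m ↑ʳ j)
        ≡⟨ QT≡Δ-Aᵀ U c (m ↑ʳ j) ⟩
      + outdeg U (m ↑ʳ j) * c (m ↑ʳ j) - (U ᵀ*ᵥ c) (m ↑ʳ j)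
        ≡⟨ cong₂ (λ o a → o * c (m ↑ʳ j) - a) (outdegʳ j) (inflowʳ j) ⟩
      + outdeg H j * drop m c j - (H ᵀ*ᵥ drop m c) j
        ≡⟨ QT≡Δ-Aᵀ H (drop m c) j ⟨
      QT H (drop m c) j ∎
      where
      open ≡-Reasoning
      U = union G H
      outdegʳ : ∀ j → + outdeg U (m ↑ʳ j) ≡ + outdeg H j
      outdegʳ j = begin
        + outdeg U (m ↑ʳ j)                 ≡⟨ +∑≡sum (U (m ↑ʳ j)) ⟩
        sum (λ x → + U (m ↑ʳ j) x)          ≡⟨ sum-drop m _ (λ i → cong +_ (union-ʳˡ j i)) ⟩
        sum (λ j′ → + U (m ↑ʳ j) (m ↑ʳ j′)) ≡⟨ sum-cong-≗ (λ j′ → cong +_ (union-ʳʳ j j′)) ⟩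
        sum (λ j′ → + H j j′)               ≡⟨ +∑≡sum (H j) ⟨
        + outdeg H j                        ∎
      inflowʳ : ∀ j → (U ᵀ*ᵥ c) (m ↑ʳ j) ≡ (H ᵀ*ᵥ drop m c) j
      inflowʳ j = trans (sum-drop m _ (λ i → cong (λ a → + a * c (i ↑ˡ k)) (union-ˡʳ i j)))
                        (sum-cong-≗ (λ j′ → cong (λ a → + a * c (m ↑ʳ j′)) (union-ʳʳ j′ j)))

  -- Pushing forward along vertex maps

  push : ∀ {n p} → (Fin n → Fin p) → Vector ℤ n → Vector ℤ p
  push f y = (λ b x → δ (f x) b) *ᵥ y

  push-linear : ∀ {n p} (f : Fin n → Fin p) → IsLinear (push f)
  push-linear f = *ᵥ-linear (λ b x → δ (f x) b)

  push-pairing : ∀ {n p} (f : Fin n → Fin p) y z → ⟨ push f y , z ⟩ ≡ ⟨ y , z ∘ f ⟩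
  push-pairing f y z = begin
    sum (λ b → push f y b * z b)
      ≡⟨ sum-cong-≗ (λ b → *-distribʳ-sum (z b) (λ x → δ (f x) b * y x)) ⟩
    sum (λ b → sum (λ x → δ (f x) b * y x * z b))
      ≡⟨ sum-cong-≗ (λ b → sum-cong-≗ (λ x → ℤ.*-assoc (δ (f x) b) (y x) (z b))) ⟩
    sum (λ b → sum (λ x → δ (f x) b * (y x * z b)))
      ≡⟨ sum-fibres f (λ x b → y x * z b) ⟩
    sum (λ x → y x * z (f x)) ∎
    where open ≡-Reasoning

  -- image sums a where-bound function of Defs; naming it here makes it available for case splits.
  image-summand : ∀ {n p} (f : Fin n → Fin p) (A : Graph n) a b →
                  Σ (Fin n → Fin n → ℕ) λ F → image f A a b ≡ ∑ (λ x → ∑ (F x))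
  image-summand f A a b = _ , refl

  +image≡sum : ∀ {n p} (f : Fin n → Fin p) (A : Graph n) a b →
               + image f A a b ≡ sum (λ x → δ (f x) a * sum (λ y → δ (f y) b * + A x y))
  +image≡sum f A a b = begin
    + ∑ (λ x → ∑ (F x))
      ≡⟨ +∑≡sum (λ x → ∑ (F x)) ⟩
    sum (λ x → + ∑ (F x))
      ≡⟨ sum-cong-≗ (λ x → trans (+∑≡sum (F x)) (sum-cong-≗ (entry x))) ⟩
    sum (λ x → sum (λ y → δ (f x) a * (δ (f y) b * + A x y)))
      ≡⟨ sum-cong-≗ (λ x → sym (*-distribˡ-sum (δ (f x) a) (λ y → δ (f y) b * + A x y))) ⟩
    sum (λ x → δ (f x) a * sum (λ y → δ (f y) b * + A x y)) ∎
    where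
    open ≡-Reasoning
    F = proj₁ (image-summand f A a b)
    entry : ∀ x y → + F x y ≡ δ (f x) a * (δ (f y) b * + A x y)
    entry x y with f x ≟ a | f y ≟ b
    ... | yes _ | yes _ = sym (trans (ℤ.*-identityˡ _) (ℤ.*-identityˡ _))
    ... | yes _ | no _  = refl
    ... | no _  | _     = refl

  module _ {n p} (f : Fin n → Fin p) (A : Graph n) where

    outdeg-image : ∀ a → + outdeg (image f A) a ≡ sum (λ x → δ (f x) a * + outdeg A x)
    outdeg-image a = begin
      + outdeg (image f A) a
        ≡⟨ +∑≡sum (image f A a) ⟩
      sum (λ b → + image f A a b)
        ≡⟨ sum-cong-≗ (+image≡sum f A a) ⟩
      sum (λ b → sum (λ x → δ (f x) a * row x b))
        ≡⟨ ∑-comm (λ b x → δ (f x) a * row x b) ⟩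
      sum (λ x → sum (λ b → δ (f x) a * row x b))
        ≡⟨ sum-cong-≗ (λ x → *-distribˡ-sum (δ (f x) a) (row x)) ⟨
      sum (λ x → δ (f x) a * sum (row x))
        ≡⟨ sum-cong-≗ (λ x → cong (δ (f x) a *_) (total x)) ⟩
      sum (λ x → δ (f x) a * + outdeg A x) ∎
      where
      open ≡-Reasoning
      row : Fin n → Fin p → ℤ
      row x b = sum (λ y → δ (f y) b * + A x y)
      total : ∀ x → sum (row x) ≡ + outdeg A x
      total x = trans (sum-fibres f (λ y _ → + A x y)) (sym (+∑≡sum (A x)))

    ᵀ*ᵥ-image : ∀ z b → (image f A ᵀ*ᵥ z) b ≡ sum (λ y → δ (f y) b * (A ᵀ*ᵥ (z ∘ f)) y)
    ᵀ*ᵥ-image z b = begin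
      sum (λ a → + image f A a b * z a)
        ≡⟨ sum-cong-≗ (λ a → cong (_* z a) (+image≡sum f A a b)) ⟩
      sum (λ a → sum (λ x → δ (f x) a * col x) * z a)
        ≡⟨ sum-cong-≗ (λ a → *-distribʳ-sum (z a) (λ x → δ (f x) a * col x)) ⟩
      sum (λ a → sum (λ x → δ (f x) a * col x * z a))
        ≡⟨ sum-cong-≗ (λ a → sum-cong-≗ (λ x → ℤ.*-assoc (δ (f x) a) (col x) (z a))) ⟩
      sum (λ a → sum (λ x → δ (f x) a * (col x * z a)))
        ≡⟨ sum-fibres f (λ x a → col x * z a) ⟩
      sum (λ x → col x * z (f x))
        ≡⟨ sum-cong-≗ (λ x → *-distribʳ-sum (z (f x)) (λ y → δ (f y) b * + A x y)) ⟩
      sum (λ x → sum (λ y → δ (f y) b * + A x y * z (f x)))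
        ≡⟨ ∑-comm (λ x y → δ (f y) b * + A x y * z (f x)) ⟩
      sum (λ y → sum (λ x → δ (f y) b * + A x y * z (f x)))
        ≡⟨ sum-cong-≗ (λ y → sum-cong-≗ (λ x → ℤ.*-assoc (δ (f y) b) (+ A x y) (z (f x)))) ⟩
      sum (λ y → sum (λ x → δ (f y) b * (+ A x y * z (f x))))
        ≡⟨ sum-cong-≗ (λ y → *-distribˡ-sum (δ (f y) b) (λ x → + A x y * z (f x))) ⟨
      sum (λ y → δ (f y) b * (A ᵀ*ᵥ (z ∘ f)) y) ∎
      where
      open ≡-Reasoning
      col : Fin n → ℤ
      col x = sum (λ y → δ (f y) b * + A x y)

    QT-image : ∀ z → QT (image f A) z ≗ push f (QT A (z ∘ f))
    QT-image z b = begin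
      QT (image f A) z b
        ≡⟨ QT≡Δ-Aᵀ (image f A) z b ⟩
      + outdeg (image f A) b * z b - (image f A ᵀ*ᵥ z) b
        ≡⟨ cong₂ (λ o a → o * z b - a) (outdeg-image b) (ᵀ*ᵥ-image z b) ⟩
      sum (λ y → D y * + outdeg A y) * z b - sum (λ y → D y * In y)
        ≡⟨ cong (_- sum (λ y → D y * In y)) degrees ⟩
      sum (λ y → D y * Δz y) - sum (λ y → D y * In y)
        ≡⟨ cong (_+_ (sum (λ y → D y * Δz y))) (sum-neg (λ y → D y * In y)) ⟨
      sum (λ y → D y * Δz y) + sum (λ y → - (D y * In y))
        ≡⟨ ∑-distrib-+ (λ y → D y * Δz y) (λ y → - (D y * In y)) ⟨
      sum (λ y → D y * Δz y + - (D y * In y))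
        ≡⟨ sum-cong-≗ (λ y → factor (D y) (Δz y) (In y)) ⟩
      sum (λ y → D y * (Δz y - In y))
        ≡⟨ sum-cong-≗ (λ y → cong (D y *_) (QT≡Δ-Aᵀ A (z ∘ f) y)) ⟨
      push f (QT A (z ∘ f)) b ∎
      where
      open ≡-Reasoning
      D Δz In : Fin n → ℤ
      D y = δ (f y) b
      Δz y = + outdeg A y * z (f y)
      In = A ᵀ*ᵥ (z ∘ f)
      factor : ∀ d u v → d * u + - (d * v) ≡ d * (u - v)
      factor = solve-∀
      degree : ∀ y → D y * + outdeg A y * z b ≡ D y * Δz y
      degree y = trans (ℤ.*-assoc (D y) (+ outdeg A y) (z b)) (sym (δ-transport (f y) b (λ c → + outdeg A y * z c)))
      degrees : sum (λ y → D y * + outdeg A y) * z b ≡ sum (λ y → D y * Δz y)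
      degrees = trans (*-distribʳ-sum (z b) (λ y → D y * + outdeg A y)) (sum-cong-≗ degree)

  push-∘ : ∀ {n p q} (f : Fin n → Fin p) (s : Fin q → Fin n) x → push f (push s x) ≗ push (f ∘ s) x
  push-∘ f s x b = begin
    sum (λ n → δ (f n) b * sum (λ a → δ (s a) n * x a))
      ≡⟨ sum-cong-≗ (λ n → *-distribˡ-sum (δ (f n) b) (λ a → δ (s a) n * x a)) ⟩
    sum (λ n → sum (λ a → δ (f n) b * (δ (s a) n * x a)))
      ≡⟨ sum-cong-≗ (λ n → sum-cong-≗ (λ a → ℤ*.x∙yz≈y∙xz (δ (f n) b) (δ (s a) n) (x a))) ⟩
    sum (λ n → sum (λ a → δ (s a) n * (δ (f n) b * x a)))
      ≡⟨ sum-fibres s (λ a n → δ (f n) b * x a) ⟩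
    sum (λ a → δ (f (s a)) b * x a) ∎
    where open ≡-Reasoning

  push-section : ∀ {n p} (f : Fin n → Fin p) (s : Fin p → Fin n) → (∀ b → f (s b) ≡ b) →
                 ∀ x → push f (push s x) ≗ x
  push-section f s f∘s≗id x b = begin
    push f (push s x) b                 ≡⟨ push-∘ f s x b ⟩
    sum (λ a → δ (f (s a)) b * x a)     ≡⟨ sum-cong-≗ (λ a → cong (λ c → δ c b * x a) (f∘s≗id a)) ⟩
    sum (λ a → δ a b * x a)             ≡⟨ sum-δᵀ b x ⟩
    x b                                 ∎
    where open ≡-Reasoning

  Onto : ∀ {n p} → (Fin n → Fin p) → Set
  Onto f = ∀ b → ∃ λ x → f x ≡ b

  module _ {n p} {f : Fin n → Fin p} {a b c d : Fin n} (f-identifies : IdentifiesExactly f a b c d) where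

    identifies-onto : Onto f
    identifies-onto = proj₁ f-identifies

    identifies₁ : f a ≡ f b
    identifies₁ = Equivalence.from (proj₂ f-identifies a b) (inj₂ (inj₁ (refl , refl)))

    identifies₂ : f c ≡ f d
    identifies₂ = Equivalence.from (proj₂ f-identifies c d) (inj₂ (inj₂ (inj₂ (inj₁ (refl , refl)))))

    factors-through : ∀ (y : Vector ℤ n) → y a ≡ y b → y c ≡ y d → ∃ λ z → y ≗ z ∘ f
    factors-through y ab cd = y ∘ section , λ x → constant-on-fibres (section (f x)) x (section-inverse (f x))
      where
      section : Fin p → Fin n
      section β = proj₁ (identifies-onto β)
      section-inverse : ∀ β → f (section β) ≡ β
      section-inverse β = proj₂ (identifies-onto β)
      constant-on-fibres : ∀ x′ x → f x′ ≡ f x → y x ≡ y x′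
      constant-on-fibres x′ x fx′≡fx with Equivalence.to (proj₂ f-identifies x′ x) fx′≡fx
      ... | inj₁ refl                                = refl
      ... | inj₂ (inj₁ (refl , refl))                = sym ab
      ... | inj₂ (inj₂ (inj₁ (refl , refl)))         = ab
      ... | inj₂ (inj₂ (inj₂ (inj₁ (refl , refl))))  = sym cd
      ... | inj₂ (inj₂ (inj₂ (inj₂ (refl , refl))))  = cd

  -- Sandpile groups

  module _ {n} (A : Graph n) where
    private module QT = IsLinear (QT-linear A)

    ≗⇒≈K : ∀ {x y} → x ≗ y → x ≈K[ A ] y
    ≗⇒≈K {x} x≗y = 𝟎 , λ i →
      trans (cong (_-_ (x i)) (sym (x≗y i))) (trans (ℤ.+-inverseʳ (x i)) (sym (QT.𝟎-homo i)))

    ≈K-sym : ∀ {x y} → x ≈K[ A ] y → y ≈K[ A ] x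
    ≈K-sym {x} {y} (z , x-y≡) = ⊝ z , λ i → begin
      y i - x i       ≡⟨ flip (x i) (y i) ⟩
      - (x i - y i)   ≡⟨ cong -_ (x-y≡ i) ⟩
      - QT A z i      ≡⟨ QT.⊝-homo z i ⟨
      QT A (⊝ z) i    ∎
      where
      open ≡-Reasoning
      flip : ∀ u v → v - u ≡ - (u - v)
      flip = solve-∀

    ≈K-trans : ∀ {x y w} → x ≈K[ A ] y → y ≈K[ A ] w → x ≈K[ A ] w
    ≈K-trans {x} {y} {w} (z , x-y≡) (z′ , y-w≡) = z ⊕ z′ , λ i → begin
      x i - w i                   ≡⟨ telescope (x i) (y i) (w i) ⟩
      (x i - y i) + (y i - w i)   ≡⟨ cong₂ _+_ (x-y≡ i) (y-w≡ i) ⟩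
      QT A z i + QT A z′ i        ≡⟨ QT.⊕-homo z z′ i ⟨
      QT A (z ⊕ z′) i             ∎
      where
      open ≡-Reasoning
      telescope : ∀ u v w → u - w ≡ (u - v) + (v - w)
      telescope = solve-∀

    ≈K-setoid : Setoid 0ℓ 0ℓ
    ≈K-setoid = record
      { Carrier       = Vector ℤ n
      ; _≈_           = _≈K[ A ]_
      ; isEquivalence = record
        { refl  = λ {x} → ≗⇒≈K {x} (λ _ → refl)
        ; sym   = λ {x} {y} → ≈K-sym {x} {y}
        ; trans = λ {x} {y} {w} → ≈K-trans {x} {y} {w}
        }
      }

  ≅-from-inverses : ∀ {p q} (A : Graph p) (B : Graph q)
    (φ : Vector ℤ p → Vector ℤ q) (ψ : Vector ℤ q → Vector ℤ p) → IsLinear φ →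
    (∀ {x y} → x ≈K[ A ] y → φ x ≈K[ B ] φ y) → (∀ {x y} → x ≈K[ B ] y → ψ x ≈K[ A ] ψ y) →
    (∀ x → ψ (φ x) ≗ x) → (∀ y → φ (ψ y) ≗ y) → 𝒦 A ≅ 𝒦 B
  ≅-from-inverses A B φ ψ φ-linear φ-cong ψ-cong ψ∘φ φ∘ψ = φ , record
    { isGroupMonomorphism = record
      { isGroupHomomorphism = record
        { isMonoidHomomorphism = record
          { isMagmaHomomorphism = record
            { isRelHomomorphism = record { cong = φ-cong }
            ; homo = λ x y → ≗⇒≈K B (φ.⊕-homo x y)
            }
          ; ε-homo = ≗⇒≈K B φ.𝟎-homo
          }
        ; ⁻¹-homo = λ x → ≗⇒≈K B (φ.⊝-homo x)
        }
      ; injective = injective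
      }
    ; surjective = λ y → ψ y , λ {z} z≈ψy → surjective y z z≈ψy
    }
    where
    module φ = IsLinear φ-linear
    injective : ∀ {x y} → φ x ≈K[ B ] φ y → x ≈K[ A ] y
    injective {x} {y} φx≈φy = begin
      x        ≈⟨ ≗⇒≈K A (λ i → sym (ψ∘φ x i)) ⟩
      ψ (φ x)  ≈⟨ ψ-cong φx≈φy ⟩
      ψ (φ y)  ≈⟨ ≗⇒≈K A (ψ∘φ y) ⟩
      y        ∎
      where open SetoidReasoning (≈K-setoid A)
    surjective : ∀ y z → z ≈K[ A ] ψ y → φ z ≈K[ B ] y
    surjective y z z≈ψy = begin
      φ z      ≈⟨ φ-cong z≈ψy ⟩
      φ (ψ y)  ≈⟨ ≗⇒≈K B (φ∘ψ y) ⟩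
      y        ∎
      where open SetoidReasoning (≈K-setoid B)

  record LinearInvolution (n : ℕ) : Set where
    field
      Ψ Ψᵀ       : Vector ℤ n → Vector ℤ n
      linear     : IsLinear Ψ
      involutive : ∀ y → Ψ (Ψ y) ≗ y
      adjoint    : ∀ y c → ⟨ Ψ y , c ⟩ ≡ ⟨ y , Ψᵀ c ⟩

  record Compatible {n p q} (A : Graph n) (Ψ Ψᵀ : Vector ℤ n → Vector ℤ n)
                    (f : Fin n → Fin p) (g : Fin n → Fin q) : Set where
    field
      pullback  : ∀ z → ∃ λ z′ → Ψᵀ (z ∘ g) ≗ z′ ∘ f
      laplacian : ∀ z → ∃ λ z′ → Ψ (QT A (z ∘ f)) ≗ QT A (z′ ∘ g)

  module Transfer {n} (A : Graph n) (R : LinearInvolution n) where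
    open LinearInvolution R

    module Direction {p q} {f : Fin n → Fin p} {g : Fin n → Fin q}
                     (onto-f : Onto f) (compatible : Compatible A Ψ Ψᵀ f g) where
      open Compatible compatible

      section : Fin p → Fin n
      section b = proj₁ (onto-f b)

      -- push g w γ pairs w with the indicator of the fibre of γ, which Ψᵀ turns into a pullback along f.
      descent : ∀ {u u′} → push f u ≗ push f u′ → push g (Ψ u) ≗ push g (Ψ u′)
      descent {u} {u′} pu≗pu′ γ = begin
        push g (Ψ u) γ      ≡⟨ via u ⟩
        ⟨ push f u , z′ ⟩   ≡⟨ sum-cong-≗ (λ b → cong (_* z′ b) (pu≗pu′ b)) ⟩
        ⟨ push f u′ , z′ ⟩  ≡⟨ via u′ ⟨
        push g (Ψ u′) γ     ∎
        where
        open ≡-Reasoning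
        fibre : Vector ℤ n
        fibre x = δ (g x) γ
        z′ = proj₁ (pullback (λ b → δ b γ))
        via : ∀ w → push g (Ψ w) γ ≡ ⟨ push f w , z′ ⟩
        via w = begin
          push g (Ψ w) γ        ≡⟨ sum-cong-≗ (λ x → ℤ.*-comm (fibre x) (Ψ w x)) ⟩
          ⟨ Ψ w , fibre ⟩       ≡⟨ adjoint w fibre ⟩
          ⟨ w , Ψᵀ fibre ⟩      ≡⟨ ⟨⟩-congʳ w (proj₂ (pullback (λ b → δ b γ))) ⟩
          ⟨ w , z′ ∘ f ⟩        ≡⟨ push-pairing f w z′ ⟨
          ⟨ push f w , z′ ⟩     ∎

      φ : Vector ℤ p → Vector ℤ q
      φ x = push g (Ψ (push section x))

      φ-linear : IsLinear φ
      φ-linear = ∘-linear (push-linear section) (∘-linear linear (push-linear g))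

      φ-cong : ∀ {x x′} → x ≈K[ image f A ] x′ → φ x ≈K[ image g A ] φ x′
      φ-cong {x} {x′} (z , x-x′≡) = z′ , λ γ → begin
        φ x γ - φ x′ γ                          ≡⟨ IsLinear.⊖-homo φ-linear x x′ γ ⟨
        push g (Ψ (push section (x ⊖ x′))) γ    ≡⟨ descent lifted γ ⟩
        push g (Ψ (QT A (z ∘ f))) γ             ≡⟨ IsLinear.cong-≗ (push-linear g) (proj₂ (laplacian z)) γ ⟩
        push g (QT A (z′ ∘ g)) γ                ≡⟨ QT-image g A z′ γ ⟨
        QT (image g A) z′ γ                     ∎
        where
        open ≡-Reasoning
        z′ = proj₁ (laplacian z)
        lifted : push f (push section (x ⊖ x′)) ≗ push f (QT A (z ∘ f))
        lifted b =
          trans (push-section f section (proj₂ ∘ onto-f) (x ⊖ x′) b) (trans (x-x′≡ b) (QT-image f A z b))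

    inverse : ∀ {p q} {f : Fin n → Fin p} {g : Fin n → Fin q} (onto-f : Onto f) (onto-g : Onto g)
              (f→g : Compatible A Ψ Ψᵀ f g) (g→f : Compatible A Ψ Ψᵀ g f) →
              ∀ x → Direction.φ onto-g g→f (Direction.φ onto-f f→g x) ≗ x
    inverse {f = f} {g} onto-f onto-g f→g g→f x b = begin
      push f (Ψ (push G.section (push g Y))) b
        ≡⟨ G.descent (push-section g G.section (proj₂ ∘ onto-g) (push g Y)) b ⟩
      push f (Ψ (Ψ (push F.section x))) b
        ≡⟨ IsLinear.cong-≗ (push-linear f) (involutive (push F.section x)) b ⟩
      push f (push F.section x) b
        ≡⟨ push-section f F.section (proj₂ ∘ onto-f) x b ⟩
      x b ∎
      where
      open ≡-Reasoning
      module F = Direction onto-f f→g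
      module G = Direction onto-g g→f
      Y = Ψ (push F.section x)

    transfer : ∀ {p q} {f : Fin n → Fin p} {g : Fin n → Fin q} → Onto f → Onto g →
               Compatible A Ψ Ψᵀ f g → Compatible A Ψ Ψᵀ g f → 𝒦 (image f A) ≅ 𝒦 (image g A)
    transfer onto-f onto-g f→g g→f =
      ≅-from-inverses _ _ F.φ G.φ F.φ-linear F.φ-cong G.φ-cong
        (inverse onto-f onto-g f→g g→f) (inverse onto-g onto-f g→f f→g)
      where
      module F = Direction onto-f f→g
      module G = Direction onto-g g→f

  -- Reflecting the H-block

  module _ {k} (e : Vector ℤ k) where

    reflect : Vector ℤ k → Vector ℤ k
    reflect y = ⊝ y ⊕ sum y ⊙ e

    reflectᵀ : Vector ℤ k → Vector ℤ k
    reflectᵀ c = ⊝ c ⊕ ⟨ e , c ⟩ ⊙ replicate k (+ 1)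

    reflect-linear : IsLinear reflect
    reflect-linear = record
      { cong-≗ = λ {x} {y} x≗y i → cong₂ (λ u s → - u + s * e i) (x≗y i) (sum-cong-≗ x≗y)
      ; ⊕-homo = λ x y i → trans (cong (λ s → - (x i + y i) + s * e i) (∑-distrib-+ x y))
                                 (distribute (x i) (y i) (sum x) (sum y) (e i))
      }
      where
      distribute : ∀ a b s t c → - (a + b) + (s + t) * c ≡ (- a + s * c) + (- b + t * c)
      distribute = solve-∀

    sum-reflect : sum e ≡ + 2 → ∀ y → sum (reflect y) ≡ sum y
    sum-reflect sum-e≡2 y = begin
      sum (reflect y)
        ≡⟨ ∑-distrib-+ (⊝ y) (sum y ⊙ e) ⟩
      sum (⊝ y) + sum (sum y ⊙ e)
        ≡⟨ cong₂ _+_ (sum-neg y) (sym (*-distribˡ-sum (sum y) e)) ⟩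
      - sum y + sum y * sum e
        ≡⟨ cong (λ s → - sum y + sum y * s) sum-e≡2 ⟩
      - sum y + sum y * + 2
        ≡⟨ twice (sum y) ⟩
      sum y ∎
      where
      open ≡-Reasoning
      twice : ∀ s → - s + s * + 2 ≡ s
      twice = solve-∀

    reflect-involutive : sum e ≡ + 2 → ∀ y → reflect (reflect y) ≗ y
    reflect-involutive sum-e≡2 y i =
      trans (cong (λ s → - reflect y i + s * e i) (sum-reflect sum-e≡2 y)) (cancel (y i) (sum y) (e i))
      where
      cancel : ∀ a s c → - (- a + s * c) + s * c ≡ a
      cancel = solve-∀

    reflect-adjoint : ∀ y c → ⟨ reflect y , c ⟩ ≡ ⟨ y , reflectᵀ c ⟩
    reflect-adjoint y c = begin
      sum (λ i → (- y i + sum y * e i) * c i)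
        ≡⟨ sum-cong-≗ (λ i → left (y i) (sum y) (e i) (c i)) ⟩
      sum (λ i → - (y i * c i) + sum y * (e i * c i))
        ≡⟨ ∑-distrib-+ (λ i → - (y i * c i)) (λ i → sum y * (e i * c i)) ⟩
      sum (λ i → - (y i * c i)) + sum (λ i → sum y * (e i * c i))
        ≡⟨ cong (_+_ (sum (λ i → - (y i * c i)))) (sym (*-distribˡ-sum (sum y) (zipWith _*_ e c))) ⟩
      sum (λ i → - (y i * c i)) + sum y * ⟨ e , c ⟩
        ≡⟨ cong (_+_ (sum (λ i → - (y i * c i)))) (*-distribʳ-sum ⟨ e , c ⟩ y) ⟩
      sum (λ i → - (y i * c i)) + sum (λ i → y i * ⟨ e , c ⟩)
        ≡⟨ ∑-distrib-+ (λ i → - (y i * c i)) (λ i → y i * ⟨ e , c ⟩) ⟨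
      sum (λ i → - (y i * c i) + y i * ⟨ e , c ⟩)
        ≡⟨ sum-cong-≗ (λ i → right (y i) (c i) ⟨ e , c ⟩) ⟩
      sum (λ i → y i * (- c i + ⟨ e , c ⟩ * + 1)) ∎
      where
      open ≡-Reasoning
      left : ∀ a s b x → (- a + s * b) * x ≡ - (a * x) + s * (b * x)
      left = solve-∀
      right : ∀ a x t → - (a * x) + a * t ≡ a * (- x + t * + 1)
      right = solve-∀

    sum≡0⇒reflect≗⊝ : ∀ {y} → sum y ≡ + 0 → reflect y ≗ ⊝ y
    sum≡0⇒reflect≗⊝ {y} sum-y≡0 i = trans (cong (λ s → - y i + s * e i) sum-y≡0) (ℤ.+-identityʳ (- y i))

  module _ (m : ℕ) {k} (φ : Vector ℤ k → Vector ℤ k) where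

    onDrop : Vector ℤ (m ℕ.+ k) → Vector ℤ (m ℕ.+ k)
    onDrop y = take m y ++ φ (drop m y)

    take-onDrop : ∀ y → take m (onDrop y) ≗ take m y
    take-onDrop y = lookup-++ˡ (take m y) (φ (drop m y))

    drop-onDrop : ∀ y → drop m (onDrop y) ≗ φ (drop m y)
    drop-onDrop y = lookup-++ʳ (take m y) (φ (drop m y))

    onDrop-linear : IsLinear φ → IsLinear onDrop
    onDrop-linear φ-linear = record
      { cong-≗ = λ {x} {y} x≗y →
          ++-cong (take m x) (take m y) (x≗y ∘ (_↑ˡ k)) (φ.cong-≗ (x≗y ∘ (m ↑ʳ_)))
      ; ⊕-homo = λ x y → ≗-blocks m
          (λ i → trans (take-onDrop (x ⊕ y) i) (sym (cong₂ _+_ (take-onDrop x i) (take-onDrop y i))))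
          (λ j → trans (drop-onDrop (x ⊕ y) j) (trans (φ.⊕-homo (drop m x) (drop m y) j)
                   (sym (cong₂ _+_ (drop-onDrop x j) (drop-onDrop y j)))))
      }
      where module φ = IsLinear φ-linear

    onDrop-involutive : IsLinear φ → (∀ y → φ (φ y) ≗ y) → ∀ y → onDrop (onDrop y) ≗ y
    onDrop-involutive φ-linear φ-involutive y = ≗-blocks m
      (λ i → trans (take-onDrop (onDrop y) i) (take-onDrop y i))
      (λ j → trans (drop-onDrop (onDrop y) j)
                   (trans (IsLinear.cong-≗ φ-linear (drop-onDrop y) j) (φ-involutive (drop m y) j)))

    onDrop-adjoint : ∀ {φᵀ : Vector ℤ k → Vector ℤ k} →
                     (∀ y c → ⟨ φ y , c ⟩ ≡ ⟨ y , φᵀ c ⟩) →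
                     ∀ y c → ⟨ onDrop y , c ⟩ ≡ ⟨ y , take m c ++ φᵀ (drop m c) ⟩
    onDrop-adjoint {φᵀ} φ-adjoint y c = begin
      ⟨ onDrop y , c ⟩
        ≡⟨ ⟨⟩-↑ m (onDrop y) c ⟩
      ⟨ take m (onDrop y) , take m c ⟩ + ⟨ drop m (onDrop y) , drop m c ⟩
        ≡⟨ cong₂ _+_ (⟨⟩-congˡ (take-onDrop y) (take m c)) (⟨⟩-congˡ (drop-onDrop y) (drop m c)) ⟩
      ⟨ take m y , take m c ⟩ + ⟨ φ (drop m y) , drop m c ⟩
        ≡⟨ cong (_+_ ⟨ take m y , take m c ⟩) (φ-adjoint (drop m y) (drop m c)) ⟩
      ⟨ take m y , take m c ⟩ + ⟨ drop m y , φᵀ (drop m c) ⟩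
        ≡⟨ cong₂ _+_ (⟨⟩-congʳ (take m y) take-onDropᵀ) (⟨⟩-congʳ (drop m y) drop-onDropᵀ) ⟨
      ⟨ take m y , take m c′ ⟩ + ⟨ drop m y , drop m c′ ⟩
        ≡⟨ ⟨⟩-↑ m y c′ ⟨
      ⟨ y , c′ ⟩ ∎
      where
      open ≡-Reasoning
      c′ = take m c ++ φᵀ (drop m c)
      take-onDropᵀ : take m c′ ≗ take m c
      take-onDropᵀ = lookup-++ˡ (take m c) (φᵀ (drop m c))
      drop-onDropᵀ : drop m c′ ≗ φᵀ (drop m c)
      drop-onDropᵀ = lookup-++ʳ (take m c) (φᵀ (drop m c))

  reflection : ∀ m {k} (e : Vector ℤ k) → sum e ≡ + 2 → LinearInvolution (m ℕ.+ k)
  reflection m e sum-e≡2 = record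
    { Ψ          = onDrop m (reflect e)
    ; Ψᵀ         = onDrop m (reflectᵀ e)
    ; linear     = onDrop-linear m (reflect e) (reflect-linear e)
    ; involutive = onDrop-involutive m (reflect e) (reflect-linear e) (reflect-involutive e sum-e≡2)
    ; adjoint    = onDrop-adjoint m (reflect e) (reflect-adjoint e)
    }

  pair : ∀ {k} → Fin k → Fin k → Vector ℤ k
  pair w₁ w₂ j = δ w₁ j + δ w₂ j

  pair-pairing : ∀ {k} (w₁ w₂ : Fin k) v → ⟨ pair w₁ w₂ , v ⟩ ≡ v w₁ + v w₂
  pair-pairing w₁ w₂ v = begin
    sum (λ j → (δ w₁ j + δ w₂ j) * v j)
      ≡⟨ sum-cong-≗ (λ j → ℤ.*-distribʳ-+ (v j) (δ w₁ j) (δ w₂ j)) ⟩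
    sum (λ j → δ w₁ j * v j + δ w₂ j * v j)
      ≡⟨ ∑-distrib-+ (λ j → δ w₁ j * v j) (λ j → δ w₂ j * v j) ⟩
    sum (λ j → δ w₁ j * v j) + sum (λ j → δ w₂ j * v j)
      ≡⟨ cong₂ _+_ (sum-δ w₁ v) (sum-δ w₂ v) ⟩
    v w₁ + v w₂ ∎
    where open ≡-Reasoning

  sum-pair : ∀ {k} (w₁ w₂ : Fin k) → sum (pair w₁ w₂) ≡ + 2
  sum-pair w₁ w₂ =
    trans (sum-cong-≗ (λ j → sym (ℤ.*-identityʳ (pair w₁ w₂ j)))) (pair-pairing w₁ w₂ (replicate _ (+ 1)))

  pair-comm : ∀ {k} (w₁ w₂ : Fin k) → pair w₁ w₂ ≗ pair w₂ w₁
  pair-comm w₁ w₂ j = ℤ.+-comm (δ w₁ j) (δ w₂ j)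

  -- Activity vectors

  minimum : ∀ {n r} (_≼_ : Fin n → Fin n → Set r) → Fin n → (∀ u v → u ≼ v ⊎ v ≼ u) →
            (∀ {u v w} → u ≼ v → v ≼ w → u ≼ w) → ∃ λ v₀ → ∀ v → v₀ ≼ v
  minimum {suc zero} _≼_ _ total _ = zero , λ { zero → [ id , id ]′ (total zero zero) }
  minimum {suc (suc n)} _≼_ _ total ≼-trans
    with minimum (λ u v → suc u ≼ suc v) zero (λ u v → total (suc u) (suc v)) ≼-trans
  ... | v , v≼ with total zero (suc v)
  ...   | inj₁ 0≼v = zero  , λ { zero → [ id , id ]′ (total zero zero) ; (suc u) → ≼-trans 0≼v (v≼ u) }
  ...   | inj₂ v≼0 = suc v , λ { zero → v≼0 ; (suc u) → v≼ u }

  module _ {k} (H : Graph k) where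

    InKernel : Vector ℕ k → Set
    InKernel y = ∀ i → QTℕ H y i ≡ + 0

    zero-upstream : ∀ {y} → InKernel y → ∀ {u v} → 1 ℕ.≤ H u v → y v ≡ 0 → y u ≡ 0
    zero-upstream {y} y-kernel {u} {v} 1≤Huv yv≡0 =
      ℕ.m*n≡0⇒m≡0 (y u) (H u v) {{ℕ.>-nonZero 1≤Huv}}
        (trans (ℕ.*-comm (y u) (H u v)) (∑≡0⇒≡0 (λ j → H j v ℕ.* y j) (ℤ.+-injective inflow≡0) u))
      where
      open ≡-Reasoning
      D = + outdeg H v * + y v
      I = (H ᵀ*ᵥ (+_ ∘ y)) v
      D≡0 : D ≡ + 0
      D≡0 = trans (cong (λ a → + outdeg H v * + a) yv≡0) (ℤ.*-zeroʳ (+ outdeg H v))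
      balance : ∀ d i → i ≡ d - (d - i)
      balance = solve-∀
      inflow≡0 : + ∑ (λ j → H j v ℕ.* y j) ≡ + 0
      inflow≡0 = begin
        + ∑ (λ j → H j v ℕ.* y j)
          ≡⟨ +∑≡sum (λ j → H j v ℕ.* y j) ⟩
        sum (λ j → + (H j v ℕ.* y j))
          ≡⟨ sum-cong-≗ (λ j → ℤ.pos-* (H j v) (y j)) ⟩
        I
          ≡⟨ balance D I ⟩
        D - (D - I)
          ≡⟨ cong (_-_ D) (QT≡Δ-Aᵀ H (+_ ∘ y) v) ⟨
        D - QTℕ H y v
          ≡⟨ cong₂ _-_ D≡0 (y-kernel v) ⟩
        + 0 ∎

    zero-along : ∀ {y} → InKernel y → ∀ {u v} → Reach H u v → y v ≡ 0 → y u ≡ 0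
    zero-along y-kernel here                 yv≡0 = yv≡0
    zero-along y-kernel (step 1≤Huw w⇝v) yv≡0 = zero-upstream y-kernel 1≤Huw (zero-along y-kernel w⇝v yv≡0)

    module _ (connected : StronglyConnected H) {h h′ : Vector ℕ k} (h-positive : ∀ i → 1 ℕ.≤ h i)
             (h-kernel : InKernel h) (h′-kernel : InKernel h′) where

      private
        _≼_ : Fin k → Fin k → Set
        u ≼ v = h′ u ℕ.* h v ℕ.≤ h′ v ℕ.* h u

        ≼-trans : ∀ {u v w} → u ≼ v → v ≼ w → u ≼ w
        ≼-trans {u} {v} {w} u≼v v≼w =
          ℕ.*-cancelʳ-≤ (h′ u ℕ.* h w) (h′ w ℕ.* h u) (h v) {{ℕ.>-nonZero (h-positive v)}} (begin
          h′ u ℕ.* h w ℕ.* h v    ≡⟨ ℕ*.xy∙z≈xz∙y (h′ u) (h w) (h v) ⟩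
          h′ u ℕ.* h v ℕ.* h w    ≤⟨ ℕ.*-monoˡ-≤ (h w) u≼v ⟩
          h′ v ℕ.* h u ℕ.* h w    ≡⟨ ℕ*.xy∙z≈xz∙y (h′ v) (h u) (h w) ⟩
          h′ v ℕ.* h w ℕ.* h u    ≤⟨ ℕ.*-monoˡ-≤ (h u) v≼w ⟩
          h′ w ℕ.* h v ℕ.* h u    ≡⟨ ℕ*.xy∙z≈xz∙y (h′ w) (h v) (h u) ⟩
          h′ w ℕ.* h u ℕ.* h v    ∎)
          where
          open ℕ.≤-Reasoning

        -- v₀ minimises h′ / h, so y = h v₀ · h′ − h′ v₀ · h is a nonnegative kernel vector vanishing at v₀.
        ratio-constant : ∀ v₀ → (∀ v → v₀ ≼ v) → ∀ v → h v₀ ℕ.* h′ v ≡ h′ v₀ ℕ.* h v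
        ratio-constant v₀ v₀-minimal v =
          ℕ.≤-antisym (ℕ.m∸n≡0⇒m≤n (zero-along y-kernel (connected v v₀) yv₀≡0)) (below v)
          where
          a = h v₀
          b = h′ v₀
          y : Vector ℕ k
          y w = a ℕ.* h′ w ℕ.∸ b ℕ.* h w
          below : ∀ w → b ℕ.* h w ℕ.≤ a ℕ.* h′ w
          below w = ℕ.≤-trans (v₀-minimal w) (ℕ.≤-reflexive (ℕ.*-comm (h′ w) a))
          y≗ : (+_ ∘ y) ≗ + a ⊙ (+_ ∘ h′) ⊖ + b ⊙ (+_ ∘ h)
          y≗ w = begin
            + (a ℕ.* h′ w ℕ.∸ b ℕ.* h w)          ≡⟨ ℤ.⊖-≥ (below w) ⟨
            a ℕ.* h′ w ℤ.⊖ b ℕ.* h w              ≡⟨ ℤ.m-n≡m⊖n (a ℕ.* h′ w) (b ℕ.* h w) ⟨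
            + (a ℕ.* h′ w) - + (b ℕ.* h w)        ≡⟨ cong₂ _-_ (ℤ.pos-* a (h′ w)) (ℤ.pos-* b (h w)) ⟩
            + a * + h′ w - + b * + h w            ∎
            where open ≡-Reasoning
          y-kernel : InKernel y
          y-kernel i = begin
            QT H (+_ ∘ y) i
              ≡⟨ QT.cong-≗ y≗ i ⟩
            QT H (+ a ⊙ (+_ ∘ h′) ⊖ + b ⊙ (+_ ∘ h)) i
              ≡⟨ QT.⊖-homo (+ a ⊙ (+_ ∘ h′)) (+ b ⊙ (+_ ∘ h)) i ⟩
            QT H (+ a ⊙ (+_ ∘ h′)) i - QT H (+ b ⊙ (+_ ∘ h)) i
              ≡⟨ cong₂ _-_ (QT-⊙ H (+ a) (+_ ∘ h′) i) (QT-⊙ H (+ b) (+_ ∘ h) i) ⟩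
            + a * QTℕ H h′ i - + b * QTℕ H h i
              ≡⟨ cong₂ (λ s t → + a * s - + b * t) (h′-kernel i) (h-kernel i) ⟩
            + a * + 0 - + b * + 0
              ≡⟨ cong₂ _-_ (ℤ.*-zeroʳ (+ a)) (ℤ.*-zeroʳ (+ b)) ⟩
            + 0 ∎
            where
            open ≡-Reasoning
            module QT = IsLinear (QT-linear H)
          yv₀≡0 : y v₀ ≡ 0
          yv₀≡0 = trans (cong (a ℕ.* b ℕ.∸_) (ℕ.*-comm b a)) (ℕ.n∸n≡0 (a ℕ.* b))

      kernel-proportional : ∀ u v → h u ℕ.* h′ v ≡ h′ u ℕ.* h v
      kernel-proportional u v =
        ℕ.*-cancelˡ-≡ (h u ℕ.* h′ v) (h′ u ℕ.* h v) (h v₀) {{ℕ.>-nonZero (h-positive v₀)}} (begin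
        h v₀ ℕ.* (h u ℕ.* h′ v)     ≡⟨ ℕ*.x∙yz≈y∙xz (h v₀) (h u) (h′ v) ⟩
        h u ℕ.* (h v₀ ℕ.* h′ v)     ≡⟨ cong (h u ℕ.*_) (ratio v) ⟩
        h u ℕ.* (h′ v₀ ℕ.* h v)     ≡⟨ ℕ*.x∙yz≈z∙yx (h u) (h′ v₀) (h v) ⟩
        h v ℕ.* (h′ v₀ ℕ.* h u)     ≡⟨ cong (h v ℕ.*_) (ratio u) ⟨
        h v ℕ.* (h v₀ ℕ.* h′ u)     ≡⟨ ℕ*.x∙yz≈y∙zx (h v) (h v₀) (h′ u) ⟩
        h v₀ ℕ.* (h′ u ℕ.* h v)     ∎)
        where
        open ≡-Reasoning
        v₀-minimum = minimum _≼_ u (λ s t → ℕ.≤-total (h′ s ℕ.* h t) (h′ t ℕ.* h s)) ≼-trans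
        v₀ = proj₁ v₀-minimum
        ratio = ratio-constant v₀ (proj₂ v₀-minimum)

    simple-vertices-share-activity : StronglyConnected H → ∀ {w₁ w₂} → Simple H w₁ → Simple H w₂ →
                                     ∃ λ h → InKernel h × h w₁ ≡ 1 × h w₂ ≡ 1
    simple-vertices-share-activity connected {w₁} {w₂}
      (h , (h-positive , _ , h-kernel) , hw₁≡1) (h′ , (_ , _ , h′-kernel) , h′w₂≡1) =
      h , h-kernel , hw₁≡1 , ℕ.m*n≡1⇒n≡1 (h′ w₁) (h w₂) (trans (sym cross) (cong₂ ℕ._*_ hw₁≡1 h′w₂≡1))
      where
      cross : h w₁ ℕ.* h′ w₂ ≡ h′ w₁ ℕ.* h w₂
      cross = kernel-proportional connected h-positive h-kernel h′-kernel w₁ w₂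

  -- Swapping the identifications

  module _ {m k} (G : Graph m) (H : Graph k) {h : Vector ℕ k} (h-kernel : InKernel H h) (e : Vector ℤ k) where

    reflect-QT-union : ∀ c t → onDrop m (reflect e) (QT (union G H) c) ≗
                               QT (union G H) (take m c ++ (⊝ drop m c ⊕ t ⊙ (+_ ∘ h)))
    reflect-QT-union c t = ≗-blocks m
      (λ i → begin
        take m (onDrop m (reflect e) (QT U c)) i   ≡⟨ take-onDrop m (reflect e) (QT U c) i ⟩
        take m (QT U c) i                          ≡⟨ QT-union-take G H c i ⟩
        QT G (take m c) i                          ≡⟨ QT.cong-≗ G (lookup-++ˡ (take m c) shifted) i ⟨
        QT G (take m c″) i                         ≡⟨ QT-union-take G H c″ i ⟨
        take m (QT U c″) i                         ∎)
      (λ j → begin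
        drop m (onDrop m (reflect e) (QT U c)) j
          ≡⟨ drop-onDrop m (reflect e) (QT U c) j ⟩
        reflect e (drop m (QT U c)) j
          ≡⟨ IsLinear.cong-≗ (reflect-linear e) (QT-union-drop G H c) j ⟩
        reflect e (QT H (drop m c)) j
          ≡⟨ sum≡0⇒reflect≗⊝ e (sum-QT H (drop m c)) j ⟩
        - QT H (drop m c) j
          ≡⟨ kernel-shift j ⟨
        QT H shifted j
          ≡⟨ QT.cong-≗ H (lookup-++ʳ (take m c) shifted) j ⟨
        QT H (drop m c″) j
          ≡⟨ QT-union-drop G H c″ j ⟨
        drop m (QT U c″) j ∎)
      where
      open ≡-Reasoning
      module QT {n} (A : Graph n) = IsLinear (QT-linear A)
      U = union G H
      shifted = ⊝ drop m c ⊕ t ⊙ (+_ ∘ h)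
      c″ = take m c ++ shifted
      kernel-shift : QT H shifted ≗ ⊝ QT H (drop m c)
      kernel-shift j = begin
        QT H shifted j
          ≡⟨ QT.⊕-homo H (⊝ drop m c) (t ⊙ (+_ ∘ h)) j ⟩
        QT H (⊝ drop m c) j + QT H (t ⊙ (+_ ∘ h)) j
          ≡⟨ cong₂ _+_ (QT.⊝-homo H (drop m c) j) (QT-⊙ H t (+_ ∘ h) j) ⟩
        - QT H (drop m c) j + t * QTℕ H h j
          ≡⟨ cong (λ s → - QT H (drop m c) j + t * s) (h-kernel j) ⟩
        - QT H (drop m c) j + t * + 0
          ≡⟨ cong (_+_ (- QT H (drop m c) j)) (ℤ.*-zeroʳ t) ⟩
        - QT H (drop m c) j + + 0
          ≡⟨ ℤ.+-identityʳ _ ⟩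
        - QT H (drop m c) j ∎

  swap-compatible : ∀ {m k} (G : Graph m) (H : Graph k) {v₁ v₂ : Fin m} {w₁ w₂ : Fin k} {h : Vector ℕ k} →
    InKernel H h → h w₁ ≡ 1 → h w₂ ≡ 1 → ∀ {e} → e ≗ pair w₁ w₂ →
    ∀ {p q} {f : Fin (m ℕ.+ k) → Fin p} {g : Fin (m ℕ.+ k) → Fin q} →
    IdentifiesExactly f (v₁ ↑ˡ k) (m ↑ʳ w₁) (v₂ ↑ˡ k) (m ↑ʳ w₂) →
    IdentifiesExactly g (v₁ ↑ˡ k) (m ↑ʳ w₂) (v₂ ↑ˡ k) (m ↑ʳ w₁) →
    Compatible (union G H) (onDrop m (reflect e)) (onDrop m (reflectᵀ e)) f g
  swap-compatible {m} {k} G H {v₁} {v₂} {w₁} {w₂} {h} h-kernel hw₁≡1 hw₂≡1 {e} e≗pair {f = f} {g}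
                  f-identifies g-identifies =
    record { pullback = pullback ; laplacian = laplacian }
    where
    a = v₁ ↑ˡ k
    b = m ↑ʳ w₁
    c = v₂ ↑ˡ k
    d = m ↑ʳ w₂
    keep-right : ∀ x w → - w + (x + w) * + 1 ≡ x
    keep-right = solve-∀
    keep-left : ∀ x w → - x + (x + w) * + 1 ≡ w
    keep-left = solve-∀
    e-pairing : ∀ v → ⟨ e , v ⟩ ≡ v w₁ + v w₂
    e-pairing v = trans (⟨⟩-congˡ e≗pair v) (pair-pairing w₁ w₂ v)

    pullback : ∀ z → ∃ λ z′ → onDrop m (reflectᵀ e) (z ∘ g) ≗ z′ ∘ f
    pullback z = factors-through f-identifies y ya≡yb yc≡yd
      where
      x = z ∘ g
      y = onDrop m (reflectᵀ e) x
      at-b : y b ≡ x d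
      at-b = trans (drop-onDrop m (reflectᵀ e) x w₁)
                   (trans (cong (λ s → - x b + s * + 1) (e-pairing (drop m x))) (keep-left (x b) (x d)))
      at-d : y d ≡ x b
      at-d = trans (drop-onDrop m (reflectᵀ e) x w₂)
                   (trans (cong (λ s → - x d + s * + 1) (e-pairing (drop m x))) (keep-right (x b) (x d)))
      ya≡yb : y a ≡ y b
      ya≡yb = trans (take-onDrop m (reflectᵀ e) x v₁) (trans (cong z (identifies₁ g-identifies)) (sym at-b))
      yc≡yd : y c ≡ y d
      yc≡yd = trans (take-onDrop m (reflectᵀ e) x v₂) (trans (cong z (identifies₂ g-identifies)) (sym at-d))

    laplacian : ∀ z → ∃ λ z′ → onDrop m (reflect e) (QT (union G H) (z ∘ f)) ≗ QT (union G H) (z′ ∘ g)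
    laplacian z = z′ , λ i →
      trans (reflect-QT-union G H h-kernel e x t i) (IsLinear.cong-≗ (QT-linear (union G H)) x″≗z′∘g i)
      where
      x = z ∘ f
      -- With h w₁ = h w₂ = 1, this t makes x″ constant on the pairs identified by g.
      t = x a + x c
      x″ = take m x ++ (⊝ drop m x ⊕ t ⊙ (+_ ∘ h))
      at : ∀ {w} → h w ≡ 1 → x″ (m ↑ʳ w) ≡ - x (m ↑ʳ w) + t * + 1
      at {w} hw≡1 = trans (lookup-++ʳ (take m x) _ w) (cong (λ n → - x (m ↑ʳ w) + t * + n) hw≡1)
      xa≡xb : x a ≡ x b
      xa≡xb = cong z (identifies₁ f-identifies)
      xc≡xd : x c ≡ x d
      xc≡xd = cong z (identifies₂ f-identifies)
      x″a≡x″d : x″ a ≡ x″ d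
      x″a≡x″d = begin
        x″ a                     ≡⟨ lookup-++ˡ (take m x) _ v₁ ⟩
        x a                      ≡⟨ keep-right (x a) (x c) ⟨
        - x c + t * + 1          ≡⟨ cong (λ s → - s + t * + 1) xc≡xd ⟩
        - x d + t * + 1          ≡⟨ at hw₂≡1 ⟨
        x″ d                     ∎
        where open ≡-Reasoning
      x″c≡x″b : x″ c ≡ x″ b
      x″c≡x″b = begin
        x″ c                     ≡⟨ lookup-++ˡ (take m x) _ v₂ ⟩
        x c                      ≡⟨ keep-left (x a) (x c) ⟨
        - x a + t * + 1          ≡⟨ cong (λ s → - s + t * + 1) xa≡xb ⟩
        - x b + t * + 1          ≡⟨ at hw₁≡1 ⟨
        x″ b                     ∎
        where open ≡-Reasoning
      x″-factors = factors-through g-identifies x″ x″a≡x″d x″c≡x″b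
      z′ = proj₁ x″-factors
      x″≗z′∘g = proj₂ x″-factors

-- Imported only here: inside the development _+_ is integer addition.
open import Data.Nat using (_+_)

proposition7p3 : ∀ {m k} (G : Graph m) (H : Graph k) (v₁ v₂ : Fin m) (w₁ w₂ : Fin k) →
    StronglyConnected G → StronglyConnected H → ¬ v₁ ≡ v₂ → ¬ w₁ ≡ w₂ →
    Simple H w₁ → Simple H w₂ →
    ∀ {p q} (f : Fin (m + k) → Fin p) (g : Fin (m + k) → Fin q) →
    IdentifiesExactly f (v₁ ↑ˡ k) (m ↑ʳ w₁) (v₂ ↑ˡ k) (m ↑ʳ w₂) →
    IdentifiesExactly g (v₁ ↑ˡ k) (m ↑ʳ w₂) (v₂ ↑ˡ k) (m ↑ʳ w₁) →
    𝒦 (image f (union G H)) ≅ 𝒦 (image g (union G H))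
proposition7p3 {m} G H v₁ v₂ w₁ w₂ _ H-connected _ _ simple₁ simple₂ f g f-identifies g-identifies =
  let _ , h-kernel , hw₁≡1 , hw₂≡1 = simple-vertices-share-activity H H-connected simple₁ simple₂
  in transfer (identifies-onto f-identifies) (identifies-onto g-identifies)
       (swap-compatible G H h-kernel hw₁≡1 hw₂≡1 (λ _ → refl) f-identifies g-identifies)
       (swap-compatible G H h-kernel hw₂≡1 hw₁≡1 (pair-comm w₁ w₂) g-identifies f-identifies)
  where open Transfer (union G H) (reflection m (pair w₁ w₂) (sum-pair w₁ w₂))
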